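{- Let $G$ be a finite simple graph. Let $d=\min\{\gamma_{2,2}(\vec{G})\}$ and $D=\max\{\gamma_{2,2}(\vec{G})\}$, where $\vec{G}$ ranges over all orientations of $G$. Then for every integer $b$ with $d\le b\le D$ there exists an orientation $\vec{G}_b$ of $G$ with $\gamma_{2,2}(\vec{G}_b)=b$.
   Context: An orientation $\vec{G}$ of a graph $G$ assigns to every edge $\{u,v\}$ exactly one direction. For vertices $u,v$ of $\vec{G}$, $d(u,v)$ is the minimum length of a directed path from $u$ to $v$ ($d(u,u)=0$; $\infty$ if none exists). Given positive integers $t,r$ and $S\subseteq V(\vec{G})$, the directed reception at $w$ is $\vec{r}(w)=\sum_{v\in S,\ d(v,w)<t}(t-d(v,w))$; $S$ is a directed $(t,r)$ broadcast dominating set if $\vec{r}(w)\ge r$ for every vertex $w$, and $\gamma_{t,r}(\vec{G})$ is the minimum cardinality of such a set. -}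

module Defs where

open import Data.Nat using (ℕ; zero; suc; _+_; _∸_; _≤_)
open import Data.Bool using (Bool; true; false; _∧_; not; if_then_else_)
open import Data.Fin using (Fin)
open import Data.Fin.Properties using (_≟_)
open import Data.Fin.Subset using (Subset; ∣_∣)
open import Data.Vec using (lookup)
open import Data.List using (List; allFin; map)
open import Data.Bool.ListAction using (any)
open import Data.Nat.ListAction using (sum)
open import Data.Maybe using (Maybe; just; nothing)
open import Data.Product using (Σ; ∃; _×_)
open import Relation.Nullary.Decidable using (⌊_⌋)
open import Relation.Binary.PropositionalEquality using (_≡_)

record Graph (n : ℕ) : Set where
  field
    Adj   : Fin n → Fin n → Bool
    irrefl : ∀ u → Adj u u ≡ false
    sym   : ∀ u v → Adj u v ≡ Adj v u
open Graph public

record Orientation {n : ℕ} (G : Graph n) : Set where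
  field
    Arc       : Fin n → Fin n → Bool
    arc⇒edge  : ∀ u v → Arc u v ≡ true → Adj G u v ≡ true
    edge⇒one  : ∀ u v → Adj G u v ≡ true → Arc u v ≡ not (Arc v u)
open Orientation public

module _ {n : ℕ} {G : Graph n} (O : Orientation G) where

  reachIn : ℕ → Fin n → Fin n → Bool
  reachIn zero    u v = ⌊ u ≟ v ⌋
  reachIn (suc k) u v = any (λ x → reachIn k u x ∧ Arc O x v) (allFin n)

  firstReach : ℕ → ℕ → Fin n → Fin n → Maybe ℕ
  firstReach start zero       u v = nothing
  firstReach start (suc fuel) u v =
    if reachIn start u v then just start else firstReach (suc start) fuel u v

  -- distBelow t u v = just d(u,v) if d(u,v) < t, nothing otherwise
  distBelow : ℕ → Fin n → Fin n → Maybe ℕ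
  distBelow t u v = firstReach zero t u v

  contrib : ℕ → Fin n → Fin n → ℕ
  contrib t v w with distBelow t v w
  ... | just d  = t ∸ d
  ... | nothing = 0

  reception : ℕ → Subset n → Fin n → ℕ
  reception t S w =
    sum (map (λ v → if lookup S v then contrib t v w else 0) (allFin n))

  IsBroadcastDom : ℕ → ℕ → Subset n → Set
  IsBroadcastDom t r S = ∀ w → r ≤ reception t S w

  IsGamma : ℕ → ℕ → ℕ → Set
  IsGamma t r k =
    (Σ (Subset n) λ S → IsBroadcastDom t r S × ∣ S ∣ ≡ k)
    × (∀ S → IsBroadcastDom t r S → k ≤ ∣ S ∣)

-- For t = r = 2 a vertex w receives 2 from itself when w ∈ S and 1 from each in-neighbour in S,
-- so whether S dominates w depends only on S and on the arcs into w. Let O₀, O₁ attain d and D.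
-- Turning the edges whose O₀-head is the vertex k into their O₁-direction, for k = 0, 1, …, n - 1
-- in turn, gives orientations O₀ = H₀, H₁, …, Hₙ = O₁ in which step k only deletes arcs into k.
-- Adding k to a minimum dominating set of H_k therefore dominates H_(k+1), so γ rises by at most
-- one per step and takes every value between d and D.
module Submission where

open import Defs
open import Data.Nat using (ℕ; _≤_)
open import Data.Product using (Σ; _×_)

open import Data.Bool using (Bool; true; false; not; if_then_else_; T)
open import Data.Bool.Properties using (T-≡; T-∧; ⇔→≡)
open import Data.Empty using (⊥-elim)
open import Data.Fin using (Fin; toℕ; fromℕ<)
open import Data.Fin.Properties using (toℕ<n; toℕ-fromℕ<; toℕ-injective; all?) renaming (_≟_ to _≟ᶠ_)
open import Data.Fin.Subset using (Subset; _∈_; _⊆_; _∪_; ⁅_⁆; ⊤; ∣_∣; inside; outside)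
open import Data.Fin.Subset.Properties using (⊆-refl; p⊆p∪q; q⊆p∪q; x∈⁅x⁆; ∈⊤; ∣⁅x⁆∣≡1; anySubset?)
open import Data.List using (List; []; _∷_; map; allFin)
open import Data.List.Membership.Propositional using (lose) renaming (_∈_ to _∈ˡ_)
open import Data.List.Membership.Propositional.Properties using (∈-allFin)
open import Data.List.Relation.Unary.Any using (here; there; satisfied)
open import Data.List.Relation.Unary.Any.Properties using (any⁺; any⁻)
open import Data.Nat using (zero; suc; _+_; _<_; _<ᵇ_; z≤n; s≤s; s≤s⁻¹; _≤?_; _≟_)
open import Data.Nat.ListAction using (sum)
open import Data.Nat.Properties
  using (module ≤-Reasoning; ≤-refl; ≤-reflexive; ≤-trans; ≤-antisym; ≮⇒≥; ≤∧≢⇒<; n≤1+n; m≤m+n; m≤n+m; m<n⇒m<1+n; +-suc; +-comm; +-mono-≤; +-monoʳ-≤; <⇒<ᵇ)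
open import Data.Product using (∃; _,_; proj₁; proj₂)
open import Data.Sum using (_⊎_; inj₁; inj₂; [_,_]′)
open import Data.Vec using ([]; _∷_; lookup)
open import Data.Vec.Properties using ([]=⇒lookup; lookup⇒[]=)
open import Function.Bundles using (mk⇔; Equivalence)
open import Function.Properties.Equivalence using () renaming (trans to ⇔-trans; sym to ⇔-sym)
open import Relation.Nullary using (yes; no; ¬_)
open import Relation.Nullary.Decidable using (⌊_⌋; toWitness; fromWitness; _×-dec_)
open import Relation.Unary using (Decidable)
open import Relation.Binary.PropositionalEquality using (_≡_; _≢_; refl; trans; cong; cong₂; subst) renaming (sym to ≡-sym)

private variable
  n : ℕ
  A : Set

sum-map-mono : (f g : A → ℕ) (xs : List A) → (∀ x → f x ≤ g x) → sum (map f xs) ≤ sum (map g xs)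
sum-map-mono f g []       f≤g = z≤n
sum-map-mono f g (x ∷ xs) f≤g = +-mono-≤ (f≤g x) (sum-map-mono f g xs f≤g)

∈⇒≤sum-map : (f : A → ℕ) {x : A} {xs : List A} → x ∈ˡ xs → f x ≤ sum (map f xs)
∈⇒≤sum-map f {xs = y ∷ ys} (here refl) = m≤m+n (f y) _
∈⇒≤sum-map f {xs = y ∷ ys} (there x∈ys) = ≤-trans (∈⇒≤sum-map f x∈ys) (m≤n+m _ (f y))

∣p∪q∣≤∣p∣+∣q∣ : (p q : Subset n) → ∣ p ∪ q ∣ ≤ ∣ p ∣ + ∣ q ∣
∣p∪q∣≤∣p∣+∣q∣ []            []            = z≤n
∣p∪q∣≤∣p∣+∣q∣ (outside ∷ p) (outside ∷ q) = ∣p∪q∣≤∣p∣+∣q∣ p q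
∣p∪q∣≤∣p∣+∣q∣ (outside ∷ p) (inside ∷ q)  =
  ≤-trans (s≤s (∣p∪q∣≤∣p∣+∣q∣ p q)) (≤-reflexive (≡-sym (+-suc ∣ p ∣ ∣ q ∣)))
∣p∪q∣≤∣p∣+∣q∣ (inside ∷ p)  (outside ∷ q) = s≤s (∣p∪q∣≤∣p∣+∣q∣ p q)
∣p∪q∣≤∣p∣+∣q∣ (inside ∷ p)  (inside ∷ q)  =
  s≤s (≤-trans (∣p∪q∣≤∣p∣+∣q∣ p q) (+-monoʳ-≤ ∣ p ∣ (n≤1+n ∣ q ∣)))

∣p∪⁅x⁆∣≤1+∣p∣ : (p : Subset n) (x : Fin n) → ∣ p ∪ ⁅ x ⁆ ∣ ≤ suc ∣ p ∣
∣p∪⁅x⁆∣≤1+∣p∣ p x = ≤-trans (∣p∪q∣≤∣p∣+∣q∣ p ⁅ x ⁆)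
  (≤-reflexive (trans (cong (∣ p ∣ +_) (∣⁅x⁆∣≡1 x)) (+-comm ∣ p ∣ 1)))

module _ {P : ℕ → Set} (P? : Decidable P) where

  Least : ℕ → Set
  Least k = P k × (∀ j → P j → k ≤ j)

  least-or-noneBelow : ∀ m → ∃ Least ⊎ (∀ j → j < m → ¬ P j)
  least-or-noneBelow zero = inj₂ (λ j ())
  least-or-noneBelow (suc m) with least-or-noneBelow m
  ... | inj₁ found = inj₁ found
  ... | inj₂ none with P? m
  ...   | yes pm = inj₁ (m , pm , λ j pj → ≮⇒≥ (λ j<m → none j j<m pj))
  ...   | no ¬pm = inj₂ none′
    where
    none′ : ∀ j → j < suc m → ¬ P j
    none′ j (s≤s j≤m) with j ≟ m
    ... | yes refl = ¬pm
    ... | no j≢m   = none j (≤∧≢⇒< j≤m j≢m)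

  least : ∀ {m} → P m → ∃ Least
  least {m} pm with least-or-noneBelow (suc m)
  ... | inj₁ found = found
  ... | inj₂ none  = ⊥-elim (none m ≤-refl pm)

intermediate-value : (g : ℕ → ℕ) (m : ℕ) → (∀ k → k < m → g (suc k) ≤ suc (g k)) →
  ∀ {b} → g 0 ≤ b → b ≤ g m → ∃ λ k → g k ≡ b
intermediate-value g zero    step g0≤b b≤gm = 0 , ≤-antisym g0≤b b≤gm
intermediate-value g (suc m) step {b} g0≤b b≤gm with g (suc m) ≟ b
... | yes gm≡b = suc m , gm≡b
... | no  gm≢b = intermediate-value g m (λ k k<m → step k (m<n⇒m<1+n k<m)) g0≤b b≤g[m]
  where
  b≤g[m] : b ≤ g m
  b≤g[m] = s≤s⁻¹ (≤-trans (≤∧≢⇒< b≤gm (λ b≡ → gm≢b (≡-sym b≡))) (step m ≤-refl))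

-- reorient a fᵥ fᵤ x is the arc u → v when a, x are the arcs u → v of the old and the new
-- orientation and fᵥ, fᵤ mark v, u as switched: an edge takes its new direction exactly when its
-- old head is switched.
reorient : (a fᵥ fᵤ x : Bool) → Bool
reorient true  fᵥ fᵤ x = if fᵥ then x else true
reorient false fᵥ fᵤ x = if fᵤ then x else false

reorient-not : ∀ a fᵥ fᵤ x → reorient (not a) fᵥ fᵤ (not x) ≡ not (reorient a fᵤ fᵥ x)
reorient-not true  fᵥ true  x = refl
reorient-not true  fᵥ false x = refl
reorient-not false true  fᵤ x = refl
reorient-not false false fᵤ x = refl

reorient-true : ∀ a fᵥ fᵤ x → reorient a fᵥ fᵤ x ≡ true → a ≡ true ⊎ x ≡ true
reorient-true true  fᵥ fᵤ   x _      = inj₁ refl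
reorient-true false fᵥ true x x≡true = inj₂ x≡true

reorient-unswitched : ∀ a x → reorient a false false x ≡ a
reorient-unswitched true  x = refl
reorient-unswitched false x = refl

reorient-switched : ∀ a x → reorient a true true x ≡ x
reorient-switched true  x = refl
reorient-switched false x = refl

reorient-mono : ∀ a fᵥ {fᵤ fᵤ′} x → (fᵤ ≡ true → fᵤ′ ≡ true) →
  reorient a fᵥ fᵤ x ≡ true → reorient a fᵥ fᵤ′ x ≡ true
reorient-mono true  fᵥ         x fᵤ⇒fᵤ′ r = r
reorient-mono false fᵥ {true}  x fᵤ⇒fᵤ′ r rewrite fᵤ⇒fᵤ′ refl = r

<ᵇ-suc : ∀ m k → (m <ᵇ k) ≡ true → (m <ᵇ suc k) ≡ true
<ᵇ-suc zero    (suc k) _   = refl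
<ᵇ-suc (suc m) (suc k) m<k = <ᵇ-suc m k m<k

<ᵇ-suc-≢ : ∀ {m k} → m ≢ k → (m <ᵇ k) ≡ (m <ᵇ suc k)
<ᵇ-suc-≢ {zero}  {zero}  m≢k = ⊥-elim (m≢k refl)
<ᵇ-suc-≢ {zero}  {suc k} m≢k = refl
<ᵇ-suc-≢ {suc m} {zero}  m≢k = refl
<ᵇ-suc-≢ {suc m} {suc k} m≢k = <ᵇ-suc-≢ (λ m≡k → m≢k (cong suc m≡k))

module _ {G : Graph n} where

  InArcs⊆ : Orientation G → Orientation G → Fin n → Set
  InArcs⊆ O O′ w = ∀ u → Arc O u w ≡ true → Arc O′ u w ≡ true

  reachIn-1 : (O : Orientation G) (v w : Fin n) → reachIn O 1 v w ≡ Arc O v w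
  reachIn-1 O v w = ⇔→≡ (⇔-trans (⇔-sym T-≡) (⇔-trans (mk⇔ reach⇒arc arc⇒reach) T-≡))
    where
    reach⇒arc : T (reachIn O 1 v w) → T (Arc O v w)
    reach⇒arc r with satisfied (any⁻ _ (allFin n) r)
    ... | x , t with Equivalence.to T-∧ t
    ...   | v≡x , arc rewrite toWitness {a? = v ≟ᶠ x} v≡x = arc
    arc⇒reach : T (Arc O v w) → T (reachIn O 1 v w)
    arc⇒reach arc = any⁺ _ (lose (∈-allFin v) (Equivalence.from T-∧ (fromWitness refl , arc)))

  contrib₂ : (O : Orientation G) (v w : Fin n) →
    contrib O 2 v w ≡ (if ⌊ v ≟ᶠ w ⌋ then 2 else if Arc O v w then 1 else 0)
  contrib₂ O v w rewrite ≡-sym (reachIn-1 O v w) with ⌊ v ≟ᶠ w ⌋ | reachIn O 1 v w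
  ... | true  | _     = refl
  ... | false | true  = refl
  ... | false | false = refl

  contrib₂-mono : ∀ {O O′ : Orientation G} {w} → InArcs⊆ O O′ w →
    ∀ v → contrib O 2 v w ≤ contrib O′ 2 v w
  contrib₂-mono {O} {O′} {w} arcs⊆ v rewrite contrib₂ O v w | contrib₂ O′ v w
    with ⌊ v ≟ᶠ w ⌋ | Arc O v w in arc
  ... | true  | _     = ≤-refl
  ... | false | true  rewrite arcs⊆ v arc = ≤-refl
  ... | false | false = z≤n

  contrib-self : (O : Orientation G) (t : ℕ) (w : Fin n) → contrib O (suc t) w w ≡ suc t
  contrib-self O t w with w ≟ᶠ w
  ... | yes _   = refl
  ... | no  w≢w = ⊥-elim (w≢w refl)

  reception-∈ : (O : Orientation G) (t : ℕ) {S : Subset n} {w : Fin n} → w ∈ S →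
    t ≤ reception O t S w
  reception-∈ O zero    w∈S = z≤n
  reception-∈ O (suc t) {S} {w} w∈S =
    ≤-trans (≤-reflexive own)
      (∈⇒≤sum-map (λ v → if lookup S v then contrib O (suc t) v w else 0) (∈-allFin w))
    where
    own : suc t ≡ (if lookup S w then contrib O (suc t) w w else 0)
    own rewrite []=⇒lookup w∈S = ≡-sym (contrib-self O t w)

  reception₂-mono : ∀ {O O′ : Orientation G} {S S′ w} → S ⊆ S′ → InArcs⊆ O O′ w →
    reception O 2 S w ≤ reception O′ 2 S′ w
  reception₂-mono {O} {O′} {S} {S′} {w} S⊆S′ arcs⊆ = sum-map-mono _ _ (allFin n) term
    where
    term : ∀ v → (if lookup S  v then contrib O  2 v w else 0)
               ≤ (if lookup S′ v then contrib O′ 2 v w else 0)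
    term v with lookup S v in v∈S
    ... | true  rewrite []=⇒lookup (S⊆S′ (lookup⇒[]= v S v∈S)) = contrib₂-mono {O} {O′} arcs⊆ v
    ... | false = z≤n

  IsBroadcastDom₂-transfer : ∀ {O O′ : Orientation G} {S S′} → S ⊆ S′ →
    (∀ w → w ∈ S′ ⊎ InArcs⊆ O O′ w) → IsBroadcastDom O 2 2 S → IsBroadcastDom O′ 2 2 S′
  IsBroadcastDom₂-transfer {O} {O′} S⊆S′ covered dom w with covered w
  ... | inj₁ w∈S′  = reception-∈ O′ 2 w∈S′
  ... | inj₂ arcs⊆ = ≤-trans (dom w) (reception₂-mono {O} {O′} S⊆S′ arcs⊆)

  IsGamma-exists : (O : Orientation G) (t r : ℕ) (S : Subset n) → IsBroadcastDom O t r S →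
    ∃ (IsGamma O t r)
  IsGamma-exists O t r S dom =
    let k , isSize , minimal = least sizeOfDom? (S , dom , refl)
    in  k , isSize , λ S′ dom′ → minimal ∣ S′ ∣ (S′ , dom′ , refl)
    where
    sizeOfDom? : Decidable (λ k → Σ (Subset n) λ S → IsBroadcastDom O t r S × ∣ S ∣ ≡ k)
    sizeOfDom? k = anySubset? (λ S → all? (λ w → r ≤? reception O t S w) ×-dec (∣ S ∣ ≟ k))

  IsGamma₂₂-exists : (O : Orientation G) → ∃ (IsGamma O 2 2)
  IsGamma₂₂-exists O = IsGamma-exists O 2 2 ⊤ (λ w → reception-∈ O 2 ∈⊤)

  γ₂₂ : Orientation G → ℕ
  γ₂₂ O = proj₁ (IsGamma₂₂-exists O)

  γ₂₂-isGamma : (O : Orientation G) → IsGamma O 2 2 (γ₂₂ O)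
  γ₂₂-isGamma O = proj₂ (IsGamma₂₂-exists O)

  IsGamma₂₂-antimono : ∀ {O O′ : Orientation G} {k k′} → (∀ w → InArcs⊆ O O′ w) →
    IsGamma O 2 2 k → IsGamma O′ 2 2 k′ → k′ ≤ k
  IsGamma₂₂-antimono {O} {O′} arcs⊆ ((S , dom , ∣S∣≡k) , _) (_ , minimal′) =
    subst (_ ≤_) ∣S∣≡k
      (minimal′ S (IsBroadcastDom₂-transfer {O = O} {O′} {S′ = S} ⊆-refl (λ w → inj₂ (arcs⊆ w)) dom))

  module _ (O₀ O₁ : Orientation G) where

    switched : (Fin n → Bool) → Orientation G
    switched F = record
      { Arc      = λ u v → reorient (Arc O₀ u v) (F v) (F u) (Arc O₁ u v)
      ; arc⇒edge = λ u v r →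
          [ arc⇒edge O₀ u v , arc⇒edge O₁ u v ]′ (reorient-true _ (F v) (F u) _ r)
      ; edge⇒one = λ u v uv → trans
          (cong₂ (λ a x → reorient a (F v) (F u) x) (edge⇒one O₀ u v uv) (edge⇒one O₁ u v uv))
          (reorient-not (Arc O₀ v u) (F v) (F u) (Arc O₁ v u))
      }

    switched-none : ∀ F → (∀ v → F v ≡ false) → ∀ w → InArcs⊆ O₀ (switched F) w
    switched-none F none w u r rewrite none u | none w =
      trans (reorient-unswitched (Arc O₀ u w) _) r

    switched-all : ∀ F → (∀ v → F v ≡ true) → ∀ w → InArcs⊆ (switched F) O₁ w
    switched-all F all w u r rewrite all u | all w =
      trans (≡-sym (reorient-switched (Arc O₀ u w) _)) r

    switched-mono : ∀ F F′ {w} → (∀ u → F u ≡ true → F′ u ≡ true) → F w ≡ F′ w →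
      InArcs⊆ (switched F) (switched F′) w
    switched-mono F F′ {w} F⊆F′ Fw≡F′w u r rewrite ≡-sym Fw≡F′w =
      reorient-mono (Arc O₀ u w) (F w) (Arc O₁ u w) (F⊆F′ u) r

  module Interpolation (O₀ O₁ : Orientation G) where

    below : ℕ → Fin n → Bool
    below k v = toℕ v <ᵇ k

    hybrid : ℕ → Orientation G
    hybrid k = switched O₀ O₁ (below k)

    γ-hybrid-zero≤ : ∀ {d} → IsGamma O₀ 2 2 d → γ₂₂ (hybrid 0) ≤ d
    γ-hybrid-zero≤ γd = IsGamma₂₂-antimono {O₀} {hybrid 0}
      (switched-none O₀ O₁ (below 0) (λ v → refl)) γd (γ₂₂-isGamma (hybrid 0))

    ≤γ-hybrid-top : ∀ {D} → IsGamma O₁ 2 2 D → D ≤ γ₂₂ (hybrid n)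
    ≤γ-hybrid-top γD = IsGamma₂₂-antimono {hybrid n} {O₁}
      (switched-all O₀ O₁ (below n) allBelow) (γ₂₂-isGamma (hybrid n)) γD
      where
      allBelow : ∀ v → (toℕ v <ᵇ n) ≡ true
      allBelow v = Equivalence.to T-≡ (<⇒<ᵇ (toℕ<n v))

    γ-hybrid-suc≤ : ∀ k → k < n → γ₂₂ (hybrid (suc k)) ≤ suc (γ₂₂ (hybrid k))
    γ-hybrid-suc≤ k k<n with γ₂₂-isGamma (hybrid k)
    ... | (S , dom , ∣S∣≡γ) , _ = begin
      γ₂₂ (hybrid (suc k)) ≤⟨ proj₂ (γ₂₂-isGamma (hybrid (suc k))) (S ∪ ⁅ x ⁆) dom′ ⟩
      ∣ S ∪ ⁅ x ⁆ ∣         ≤⟨ ∣p∪⁅x⁆∣≤1+∣p∣ S x ⟩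
      suc ∣ S ∣             ≡⟨ cong suc ∣S∣≡γ ⟩
      suc (γ₂₂ (hybrid k))  ∎
      where
      open ≤-Reasoning
      x : Fin n
      x = fromℕ< k<n
      covered : ∀ w → w ∈ S ∪ ⁅ x ⁆ ⊎ InArcs⊆ (hybrid k) (hybrid (suc k)) w
      covered w with toℕ w ≟ k
      ... | yes w≡k = inj₁ (q⊆p∪q S ⁅ x ⁆ (subst (_∈ ⁅ x ⁆) x≡w (x∈⁅x⁆ x)))
        where
        x≡w : x ≡ w
        x≡w = toℕ-injective (trans (toℕ-fromℕ< k<n) (≡-sym w≡k))
      ... | no  w≢k = inj₂
        (switched-mono O₀ O₁ (below k) (below (suc k)) (λ u → <ᵇ-suc (toℕ u) k) (<ᵇ-suc-≢ w≢k))
      dom′ : IsBroadcastDom (hybrid (suc k)) 2 2 (S ∪ ⁅ x ⁆)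
      dom′ = IsBroadcastDom₂-transfer {hybrid k} {hybrid (suc k)} (p⊆p∪q ⁅ x ⁆) covered dom

mainTheorem3 : (n : ℕ) (G : Graph n) (d D : ℕ)
    → ((Σ (Orientation G) λ O → IsGamma O 2 2 d) × (∀ (O : Orientation G) k → IsGamma O 2 2 k → d ≤ k))
    → ((Σ (Orientation G) λ O → IsGamma O 2 2 D) × (∀ (O : Orientation G) k → IsGamma O 2 2 k → k ≤ D))
    → (b : ℕ) → d ≤ b → b ≤ D
    → Σ (Orientation G) λ O → IsGamma O 2 2 b
mainTheorem3 n G d D ((O₀ , γd) , _) ((O₁ , γD) , _) b d≤b b≤D =
  let k , γ≡b = intermediate-value (λ k → γ₂₂ (hybrid k)) n γ-hybrid-suc≤
                  (≤-trans (γ-hybrid-zero≤ γd) d≤b) (≤-trans b≤D (≤γ-hybrid-top γD))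
  in  hybrid k , subst (IsGamma (hybrid k) 2 2) γ≡b (γ₂₂-isGamma (hybrid k))
  where open Interpolation O₀ O₁
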